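{- For every integer $n\ge 1$, each of the sets $\mathcal{S}_n(1\text{ - }23,\,2\text{ - }13)$, $\mathcal{S}_n(3\text{ - }21,\,2\text{ - }31)$, $\mathcal{S}_n(12\text{ - }3,\,13\text{ - }2)$, $\mathcal{S}_n(32\text{ - }1,\,31\text{ - }2)$ has cardinality $2^{n-1}$.
   Context: A permutation of $[n]=\{1,\dots,n\}$ is written as a word $\pi=a_1a_2\cdots a_n$. For a permutation $xyz$ of $\{1,2,3\}$: $\pi$ contains the pattern $x\text{ - }yz$ if there are indices $1\le i<j<n$ such that $a_i,a_j,a_{j+1}$ are in the same relative order as $x,y,z$; $\pi$ contains the pattern $xy\text{ - }z$ if there are indices $i$ and $k$ with $i+1<k\le n$ such that $a_i,a_{i+1},a_k$ are in the same relative order as $x,y,z$. $\pi$ avoids a pattern if it does not contain it. $\mathcal{S}_n(p,q)$ is the set of permutations of $[n]$ avoiding both $p$ and $q$. -}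

module Defs where

open import Data.Nat using (ℕ; zero; suc; _<_; _+_)
open import Data.Fin using (Fin; toℕ)
open import Data.Vec using (Vec; lookup)
open import Data.Product using (Σ; _×_; _,_; ∃-syntax)
open import Data.Empty using (⊥)
open import Relation.Binary.PropositionalEquality using (_≡_)
open import Relation.Nullary using (¬_)
open import Function.Bundles using (_⇔_)

-- A permutation of [n] written as a word a₁…aₙ : a vector of length n with
-- entries in Fin n (value v represents v+1) that is injective (hence bijective).
IsPerm : {n : ℕ} → Vec (Fin n) n → Set
IsPerm {n} w = ∀ (i j : Fin n) → lookup w i ≡ lookup w j → i ≡ j

record Pat3 : Set where
  constructor pat
  field
    x y z : ℕ

SameOrder : ℕ → ℕ → ℕ → Pat3 → Set
SameOrder a b c (pat x y z) =
  ((a < b) ⇔ (x < y)) × ((a < c) ⇔ (x < z)) × ((b < c) ⇔ (y < z))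

-- π contains x-yz : indices i < j with j+1 ≤ n-1 (0-based), a_i a_j a_{j+1} ~ xyz
ContainsDashFirst : {n : ℕ} → Pat3 → Vec (Fin n) n → Set
ContainsDashFirst {n} p w =
  ∃[ i ] ∃[ j ] Σ (toℕ i < toℕ j) λ _ → Σ (suc (toℕ j) < n) λ _ →
    ∃[ j' ] (toℕ j' ≡ suc (toℕ j)) ×
      SameOrder (toℕ (lookup w i)) (toℕ (lookup w j)) (toℕ (lookup w j')) p

-- π contains xy-z : indices i, k with i+1 < k, a_i a_{i+1} a_k ~ xyz
ContainsDashLast : {n : ℕ} → Pat3 → Vec (Fin n) n → Set
ContainsDashLast {n} p w =
  ∃[ i ] ∃[ i' ] ∃[ k ] (toℕ i' ≡ suc (toℕ i)) × (toℕ i' < toℕ k) ×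
      SameOrder (toℕ (lookup w i)) (toℕ (lookup w i')) (toℕ (lookup w k)) p

data GPat : Set where
  _-_  : ℕ → ℕ × ℕ → GPat
  _⁻_  : ℕ × ℕ → ℕ → GPat

Contains : {n : ℕ} → GPat → Vec (Fin n) n → Set
Contains (x - (y , z)) w = ContainsDashFirst (pat x y z) w
Contains ((x , y) ⁻ z) w = ContainsDashLast (pat x y z) w

Avoids : {n : ℕ} → GPat → Vec (Fin n) n → Set
Avoids p w = ¬ Contains p w

InS : (n : ℕ) → GPat → GPat → Vec (Fin n) n → Set
InS n p q w = IsPerm w × Avoids p w × Avoids q w

-- |S_n(p,q)| = k : an explicit bijection between Fin k and S_n(p,q)
-- (elements of S_n(p,q) compared as words, i.e. by _≡_ on Vec).
HasCard : (n : ℕ) → GPat → GPat → ℕ → Set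
HasCard n p q k =
  Σ (Fin k → Vec (Fin n) n) λ f →
    (∀ i → InS n p q (f i)) ×
    (∀ i j → f i ≡ f j → i ≡ j) ×
    (∀ w → InS n p q w → ∃[ i ] f i ≡ w)

-- In a permutation avoiding 1-23 and 2-13 the largest entry lies in one of the first two positions:
-- otherwise the first entry and the entry just before the largest one form a 1-23 or a 2-13 with it.
-- Conversely, inserting the largest entry in front of, or right after the first entry of, a word
-- neither creates nor destroys an occurrence of a pattern x-yz whose last letter is its largest.
-- So removing the largest entry is two-to-one from S_{n+1}(1-23,2-13) onto S_n(1-23,2-13), and the
-- count doubles at each step. Complementation maps 1-23, 2-13 to 3-21, 2-31, and reversal maps x-yz
-- to zy-x, which gives the other three classes.
module Submission where

open import Defs
open import Data.Nat using (ℕ; zero; suc; _≥_; _^_; _∸_; _+_; _<_; _≤_; _<ᵇ_; s≤s; s≤s⁻¹; z<s; s<s)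
open import Data.Nat.Properties
  using (<-cmp; ≤∧≢⇒<; ≮⇒≥; ≰⇒>; <-asym; <⇒≢; <⇒≱; <-trans; ≤-reflexive; <ᵇ⇒<; <⇒<ᵇ; n<1+n;
         +-∸-assoc; ∸-monoʳ-<; ∸-monoʳ-≤; +-identityʳ)
  renaming (suc-injective to ℕ-suc-injective)
open import Data.Bool using (T)
open import Data.Fin
  using (Fin; zero; suc; toℕ; fromℕ; inject₁; lower₁; punchIn; punchOut; opposite; splitAt; join; _↑ˡ_; _↑ʳ_; _≟_)
open import Data.Fin.Properties
  using (toℕ-injective; toℕ<n; toℕ-fromℕ; toℕ-inject₁; inject₁ℕ<; inject₁-injective; fromℕ≢inject₁;
         inject₁-lower₁;
         punchIn-injective; punchInᵢ≢i; punchOut-injective; punchIn-punchOut; any?; <⇒notInjective;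
         opposite-prop; opposite-involutive; splitAt-↑ˡ; splitAt-↑ʳ; join-splitAt)
open import Data.Vec using (Vec; []; _∷_; lookup; map; tabulate; insertAt)
open import Data.Vec.Properties using (lookup-map; lookup∘tabulate; insertAt-lookup; insertAt-punchIn; ∷-injectiveˡ)
open import Data.Vec.Relation.Binary.Pointwise.Extensional using (ext; Pointwise-≡⇒≡)
open import Data.Product using (Σ; ∃-syntax; _×_; _,_; proj₁; proj₂)
open import Data.Sum using (_⊎_; inj₁; inj₂; [_,_]′)
open import Data.Sum.Properties using (inj₁-injective; inj₂-injective)
import Data.Sum as Sum
open import Data.Empty using (⊥-elim)
open import Function.Base using (_∘_; const)
open import Function.Bundles using (_⇔_; mk⇔; module Equivalence)
open import Function.Definitions using (Injective)
open import Function.Properties.Equivalence using () renaming (sym to ⇔-sym; trans to ⇔-trans)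
open import Relation.Binary.PropositionalEquality
  using (_≡_; _≢_; ≢-sym; refl; sym; trans; cong; subst; module ≡-Reasoning)
open import Relation.Binary.Definitions using (Tri; tri<; tri≈; tri>)
open import Relation.Nullary using (¬_; yes; no)
open import Relation.Unary using (_⟨⊎⟩_)

open Equivalence using (to; from)

private
  variable
    A B : Set
    k l m n : ℕ

Counts : (A → Set) → ℕ → Set
Counts {A} P k =
  Σ (Fin k → A) λ f →
    (∀ i → P (f i)) × (∀ i j → f i ≡ f j → i ≡ j) × (∀ a → P a → ∃[ i ] f i ≡ a)

Counts-image : {P : A → Set} {Q : B → Set} (g : A → B) → Injective _≡_ _≡_ g →
               (∀ a → P a → Q (g a)) → (∀ b → Q b → ∃[ a ] P a × g a ≡ b) →
               Counts P k → Counts Q k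
Counts-image {P = P} {Q} g g-injective P⇒Q Q⇒P (f , fP , f-injective , f-onto) =
  g ∘ f , (λ i → P⇒Q (f i) (fP i)) , (λ i j → f-injective i j ∘ g-injective) , onto
  where
  onto : ∀ b → Q b → ∃[ i ] g (f i) ≡ b
  onto b qb with a , pa , refl ← Q⇒P b qb with i , refl ← f-onto a pa = i , refl

Counts-⊎ : {P : A → Set} {Q : B → Set} → Counts P k → Counts Q l → Counts (P ⟨⊎⟩ Q) (k + l)
Counts-⊎ {k = k} {l = l} {P = P} {Q} (f , fP , f-injective , f-onto) (g , gQ , g-injective , g-onto) =
  h ∘ splitAt k , hPQ ∘ splitAt k , injective , onto
  where
  h : Fin k ⊎ Fin l → _ ⊎ _
  h = Sum.map f g

  hPQ : ∀ s → (P ⟨⊎⟩ Q) (h s)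
  hPQ (inj₁ i) = fP i
  hPQ (inj₂ j) = gQ j

  h-injective : ∀ s t → h s ≡ h t → s ≡ t
  h-injective (inj₁ i) (inj₁ j) e = cong inj₁ (f-injective i j (inj₁-injective e))
  h-injective (inj₂ i) (inj₂ j) e = cong inj₂ (g-injective i j (inj₂-injective e))

  injective : ∀ i j → h (splitAt k i) ≡ h (splitAt k j) → i ≡ j
  injective i j e = begin
    i                      ≡⟨ join-splitAt k l i ⟨
    join k l (splitAt k i) ≡⟨ cong (join k l) (h-injective (splitAt k i) (splitAt k j) e) ⟩
    join k l (splitAt k j) ≡⟨ join-splitAt k l j ⟩
    j                      ∎
    where open ≡-Reasoning

  onto : ∀ s → (P ⟨⊎⟩ Q) s → ∃[ i ] h (splitAt k i) ≡ s
  onto (inj₁ a) pa with i , refl ← f-onto a pa = i ↑ˡ l , cong h (splitAt-↑ˡ k i l)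
  onto (inj₂ b) qb with j , refl ← g-onto b qb = k ↑ʳ j , cong h (splitAt-↑ʳ k l j)

Distinct : ℕ → ℕ → ℕ → Set
Distinct a b c = a ≢ b × a ≢ c × b ≢ c

-- The primed triple is in the opposite relative order, as (N ∸ a, N ∸ b, N ∸ c) is to (a, b, c).
Mirrored : ℕ → ℕ → ℕ → ℕ → ℕ → ℕ → Set
Mirrored a b c a′ b′ c′ = (a′ < b′ ⇔ b < a) × (a′ < c′ ⇔ c < a) × (b′ < c′ ⇔ c < b)

≢∧≮⇒> : ∀ {a b} → a ≢ b → ¬ a < b → b < a
≢∧≮⇒> a≢b a≮b = ≤∧≢⇒< (≮⇒≥ a≮b) (≢-sym a≢b)

⇔-of-both : {P Q : Set} → P → Q → P ⇔ Q
⇔-of-both p q = mk⇔ (const q) (const p)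

⇔-of-neither : {P Q : Set} → ¬ P → ¬ Q → P ⇔ Q
⇔-of-neither ¬p ¬q = mk⇔ (⊥-elim ∘ ¬p) (⊥-elim ∘ ¬q)

<-⇔-swap : ∀ {a b x y} → a ≢ b → x ≢ y → (a < b ⇔ x < y) → (b < a ⇔ y < x)
<-⇔-swap a≢b x≢y a<b⇔x<y = mk⇔
  (λ b<a → ≢∧≮⇒> x≢y (<-asym b<a ∘ from a<b⇔x<y))
  (λ y<x → ≢∧≮⇒> a≢b (<-asym y<x ∘ to a<b⇔x<y))

<-⇔-mirror : ∀ {a b a′ b′ x y x′ y′} → a ≢ b → x ≢ y →
             (a′ < b′ ⇔ b < a) → (x′ < y′ ⇔ y < x) → (a < b ⇔ x < y) → (a′ < b′ ⇔ x′ < y′)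
<-⇔-mirror a≢b x≢y a′b′ x′y′ ab = ⇔-trans a′b′ (⇔-trans (<-⇔-swap a≢b x≢y ab) (⇔-sym x′y′))

<-⇔-by-computation : ∀ {a b c d} → (a <ᵇ b) ≡ (c <ᵇ d) → (a < b ⇔ c < d)
<-⇔-by-computation {a} {b} {c} {d} eq = mk⇔
  (λ a<b → <ᵇ⇒< c d (subst T eq (<⇒<ᵇ a<b)))
  (λ c<d → <ᵇ⇒< a b (subst T (sym eq) (<⇒<ᵇ c<d)))

Mirrored-by-computation : ∀ {x y z x′ y′ z′} → (x′ <ᵇ y′) ≡ (y <ᵇ x) → (x′ <ᵇ z′) ≡ (z <ᵇ x) →
                          (y′ <ᵇ z′) ≡ (z <ᵇ y) → Mirrored x y z x′ y′ z′
Mirrored-by-computation e₁ e₂ e₃ = <-⇔-by-computation e₁ , <-⇔-by-computation e₂ , <-⇔-by-computation e₃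

Mirrored-sym : ∀ {x y z x′ y′ z′} → Distinct x y z → Distinct x′ y′ z′ →
               Mirrored x y z x′ y′ z′ → Mirrored x′ y′ z′ x y z
Mirrored-sym (x≢y , x≢z , y≢z) (x′≢y′ , x′≢z′ , y′≢z′) (m₁ , m₂ , m₃) =
  ⇔-sym (<-⇔-swap x′≢y′ (≢-sym x≢y) m₁) ,
  ⇔-sym (<-⇔-swap x′≢z′ (≢-sym x≢z) m₂) ,
  ⇔-sym (<-⇔-swap y′≢z′ (≢-sym y≢z) m₃)

SameOrder-respects : ∀ {a b c a′ b′ c′ p} → a ≡ a′ → b ≡ b′ → c ≡ c′ →
                     SameOrder a b c p → SameOrder a′ b′ c′ p
SameOrder-respects refl refl refl s = s

SameOrder-reverse : ∀ {a b c x y z} → Distinct a b c → Distinct x y z →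
                    SameOrder a b c (pat x y z) → SameOrder c b a (pat z y x)
SameOrder-reverse (a≢b , a≢c , b≢c) (x≢y , x≢z , y≢z) (ab , ac , bc) =
  <-⇔-swap b≢c y≢z bc , <-⇔-swap a≢c x≢z ac , <-⇔-swap a≢b x≢y ab

SameOrder-mirror : ∀ {a b c a′ b′ c′ x y z x′ y′ z′} → Distinct a b c → Distinct x y z →
                   Mirrored a b c a′ b′ c′ → Mirrored x y z x′ y′ z′ →
                   SameOrder a b c (pat x y z) → SameOrder a′ b′ c′ (pat x′ y′ z′)
SameOrder-mirror (a≢b , a≢c , b≢c) (x≢y , x≢z , y≢z) (m₁ , m₂ , m₃) (n₁ , n₂ , n₃) (ab , ac , bc) =
  <-⇔-mirror a≢b x≢y m₁ n₁ ab , <-⇔-mirror a≢c x≢z m₂ n₂ ac , <-⇔-mirror b≢c y≢z m₃ n₃ bc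

value : Vec (Fin m) n → Fin n → ℕ
value w i = toℕ (lookup w i)

values-distinct : (w : Vec (Fin n) n) {i j : Fin n} → IsPerm w → toℕ i < toℕ j → value w i ≢ value w j
values-distinct w pw i<j e = <⇒≢ i<j (cong toℕ (pw _ _ (toℕ-injective e)))

occurrence-distinct : (w : Vec (Fin n) n) {i j k : Fin n} → IsPerm w →
                      toℕ i < toℕ j → toℕ j < toℕ k → Distinct (value w i) (value w j) (value w k)
occurrence-distinct w pw i<j j<k =
  values-distinct w pw i<j , values-distinct w pw (<-trans i<j j<k) , values-distinct w pw j<k

involutive⇒injective : {f : A → A} → (∀ a → f (f a) ≡ a) → Injective _≡_ _≡_ f
involutive⇒injective {f = f} f-involutive {a} {b} e =
  trans (sym (f-involutive a)) (trans (cong f e) (f-involutive b))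

opposite-<-⇔ : (i j : Fin n) → toℕ (opposite i) < toℕ (opposite j) ⇔ toℕ j < toℕ i
opposite-<-⇔ {n} i j rewrite opposite-prop i | opposite-prop j = mk⇔
  (λ lt → ≰⇒> (λ i≤j → <⇒≱ lt (∸-monoʳ-≤ n (s≤s i≤j))))
  (λ j<i → ∸-monoʳ-< (s≤s j<i) (toℕ<n i))

opposite-adjacent : (i j : Fin n) → toℕ j ≡ suc (toℕ i) → toℕ (opposite i) ≡ suc (toℕ (opposite j))
opposite-adjacent {n} i j j≡1+i = begin
  toℕ (opposite i)            ≡⟨ opposite-prop i ⟩
  n ∸ suc (toℕ i)             ≡⟨ +-∸-assoc 1 (subst (_< n) j≡1+i (toℕ<n j)) ⟩
  suc (n ∸ suc (suc (toℕ i))) ≡⟨ cong (λ t → suc (n ∸ suc t)) (sym j≡1+i) ⟩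
  suc (n ∸ suc (toℕ j))       ≡⟨ cong suc (sym (opposite-prop j)) ⟩
  suc (toℕ (opposite j))      ∎
  where open ≡-Reasoning

Distinct-reverse : ∀ {a b c} → Distinct a b c → Distinct c b a
Distinct-reverse (a≢b , a≢c , b≢c) = ≢-sym b≢c , ≢-sym a≢c , ≢-sym a≢b

reverse : Vec A n → Vec A n
reverse w = tabulate (lookup w ∘ opposite)

lookup-reverse : (w : Vec A n) (i : Fin n) → lookup (reverse w) i ≡ lookup w (opposite i)
lookup-reverse w = lookup∘tabulate (lookup w ∘ opposite)

lookup-reverse-opposite : (w : Vec A n) (i : Fin n) → lookup (reverse w) (opposite i) ≡ lookup w i
lookup-reverse-opposite w i = trans (lookup-reverse w (opposite i)) (cong (lookup w) (opposite-involutive i))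

value-reverse-opposite : (w : Vec (Fin m) n) (i : Fin n) → value (reverse w) (opposite i) ≡ value w i
value-reverse-opposite w i = cong toℕ (lookup-reverse-opposite w i)

reverse-involutive : (w : Vec A n) → reverse (reverse w) ≡ w
reverse-involutive w = Pointwise-≡⇒≡ (ext λ i → trans (lookup-reverse (reverse w) i) (lookup-reverse-opposite w i))

reverse-IsPerm : (w : Vec (Fin n) n) → IsPerm w → IsPerm (reverse w)
reverse-IsPerm w pw i j e = involutive⇒injective {f = opposite} opposite-involutive
  (pw _ _ (trans (sym (lookup-reverse w i)) (trans e (lookup-reverse w j))))

module _ {x y z : ℕ} (w : Vec (Fin n) n) (pw : IsPerm w) (xyz : Distinct x y z) where

  reverse-dashFirst : ContainsDashFirst (pat x y z) w → ContainsDashLast (pat z y x) (reverse w)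
  reverse-dashFirst (i , j , i<j , _ , j′ , j′≡1+j , s) =
    opposite j′ , opposite j , opposite i , opposite-adjacent j j′ j′≡1+j , from (opposite-<-⇔ j i) i<j ,
    SameOrder-respects (sym (value-reverse-opposite w j′)) (sym (value-reverse-opposite w j))
      (sym (value-reverse-opposite w i))
      (SameOrder-reverse (occurrence-distinct w pw i<j (≤-reflexive (sym j′≡1+j))) xyz s)

  reverse-dashLast : ContainsDashLast (pat x y z) w → ContainsDashFirst (pat z y x) (reverse w)
  reverse-dashLast (i , i′ , k , i′≡1+i , i′<k , s) =
    opposite k , opposite i′ , from (opposite-<-⇔ k i′) i′<k ,
    subst (_< n) (opposite-adjacent i i′ i′≡1+i) (toℕ<n (opposite i)) ,
    opposite i , opposite-adjacent i i′ i′≡1+i ,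
    SameOrder-respects (sym (value-reverse-opposite w k)) (sym (value-reverse-opposite w i′))
      (sym (value-reverse-opposite w i))
      (SameOrder-reverse (occurrence-distinct w pw (≤-reflexive (sym i′≡1+i)) i′<k) xyz s)

dashFirst-reverse-⇔ : ∀ {x y z} (w : Vec (Fin n) n) → IsPerm w → Distinct x y z →
                      ContainsDashFirst (pat x y z) w ⇔ ContainsDashLast (pat z y x) (reverse w)
dashFirst-reverse-⇔ {x = x} {y} {z} w pw xyz = mk⇔ (reverse-dashFirst w pw xyz)
  (subst (ContainsDashFirst (pat x y z)) (reverse-involutive w)
    ∘ reverse-dashLast (reverse w) (reverse-IsPerm w pw) (Distinct-reverse xyz))

complement : Vec (Fin n) m → Vec (Fin n) m
complement = map opposite

value-complement : (w : Vec (Fin n) m) (i : Fin m) → value (complement w) i ≡ toℕ (opposite (lookup w i))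
value-complement w i = cong toℕ (lookup-map i opposite w)

complement-involutive : (w : Vec (Fin n) m) → complement (complement w) ≡ w
complement-involutive w = Pointwise-≡⇒≡ (ext λ i → begin
  lookup (complement (complement w)) i ≡⟨ lookup-map i opposite (complement w) ⟩
  opposite (lookup (complement w) i)   ≡⟨ cong opposite (lookup-map i opposite w) ⟩
  opposite (opposite (lookup w i))     ≡⟨ opposite-involutive (lookup w i) ⟩
  lookup w i                           ∎)
  where open ≡-Reasoning

complement-IsPerm : (w : Vec (Fin n) n) → IsPerm w → IsPerm (complement w)
complement-IsPerm w pw i j e = pw i j (involutive⇒injective {f = opposite} opposite-involutive
  (trans (sym (lookup-map i opposite w)) (trans e (lookup-map j opposite w))))

complement-dashFirst : ∀ {x y z x′ y′ z′} (w : Vec (Fin n) n) → IsPerm w →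
                       Distinct x y z → Mirrored x y z x′ y′ z′ →
                       ContainsDashFirst (pat x y z) w → ContainsDashFirst (pat x′ y′ z′) (complement w)
complement-dashFirst w pw xyz mirrored (i , j , i<j , j+1<n , j′ , j′≡1+j , s) =
  i , j , i<j , j+1<n , j′ , j′≡1+j ,
  SameOrder-respects (sym (value-complement w i)) (sym (value-complement w j)) (sym (value-complement w j′))
    (SameOrder-mirror (occurrence-distinct w pw i<j (≤-reflexive (sym j′≡1+j))) xyz
      (opposite-<-⇔ (lookup w i) (lookup w j) , opposite-<-⇔ (lookup w i) (lookup w j′) ,
       opposite-<-⇔ (lookup w j) (lookup w j′))
      mirrored s)

dashFirst-complement-⇔ : ∀ {x y z x′ y′ z′} (w : Vec (Fin n) n) → IsPerm w →
                         Distinct x y z → Distinct x′ y′ z′ → Mirrored x y z x′ y′ z′ →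
                         ContainsDashFirst (pat x y z) w ⇔ ContainsDashFirst (pat x′ y′ z′) (complement w)
dashFirst-complement-⇔ {x = x} {y} {z} w pw xyz x′y′z′ mirrored = mk⇔ (complement-dashFirst w pw xyz mirrored)
  (subst (ContainsDashFirst (pat x y z)) (complement-involutive w)
    ∘ complement-dashFirst (complement w) (complement-IsPerm w pw) x′y′z′ (Mirrored-sym xyz x′y′z′ mirrored))

InS-⇔ : ∀ {p q p′ q′} {w : Vec (Fin n) n} {w′ : Vec (Fin m) m} → (IsPerm w ⇔ IsPerm w′) →
        (IsPerm w → Contains p w ⇔ Contains p′ w′) → (IsPerm w → Contains q w ⇔ Contains q′ w′) →
        InS n p q w ⇔ InS m p′ q′ w′
InS-⇔ perm⇔ p⇔ q⇔ = mk⇔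
  (λ (pw , avoid-p , avoid-q) → to perm⇔ pw , avoid-p ∘ from (p⇔ pw) , avoid-q ∘ from (q⇔ pw))
  (λ (pw′ , avoid-p′ , avoid-q′) → let pw = from perm⇔ pw′ in
     pw , avoid-p′ ∘ to (p⇔ pw) , avoid-q′ ∘ to (q⇔ pw))

HasCard-transport : ∀ {p q p′ q′} (φ : Vec (Fin n) n → Vec (Fin n) n) → (∀ w → φ (φ w) ≡ w) →
                    (∀ w → IsPerm w → IsPerm (φ w)) →
                    (∀ w → IsPerm w → Contains p w ⇔ Contains p′ (φ w)) →
                    (∀ w → IsPerm w → Contains q w ⇔ Contains q′ (φ w)) →
                    HasCard n p q k → HasCard n p′ q′ k
HasCard-transport {n = n} {p = p} {q} {p′} {q′} φ φ-involutive φ-perm p⇔ q⇔ =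
  Counts-image φ (involutive⇒injective φ-involutive) (to ∘ InS⇔) onto
  where
  InS⇔ : ∀ w → InS n p q w ⇔ InS n p′ q′ (φ w)
  InS⇔ w = InS-⇔ (mk⇔ (φ-perm w) (subst IsPerm (φ-involutive w) ∘ φ-perm (φ w))) (p⇔ w) (q⇔ w)

  onto : ∀ w′ → InS n p′ q′ w′ → ∃[ w ] InS n p q w × φ w ≡ w′
  onto w′ s =
    φ w′ , from (InS⇔ (φ w′)) (subst (InS n p′ q′) (sym (φ-involutive w′)) s) , φ-involutive w′

insertMax : Fin (suc n) → Vec (Fin n) n → Vec (Fin (suc n)) (suc n)
insertMax {n} pos w = insertAt (map inject₁ w) pos (fromℕ n)

module _ (pos : Fin (suc n)) (w : Vec (Fin n) n) where

  lookup-insertMax : lookup (insertMax pos w) pos ≡ fromℕ n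
  lookup-insertMax = insertAt-lookup (map inject₁ w) pos (fromℕ n)

  lookup-insertMax-punchIn : ∀ i → lookup (insertMax pos w) (punchIn pos i) ≡ inject₁ (lookup w i)
  lookup-insertMax-punchIn i = trans (insertAt-punchIn (map inject₁ w) pos (fromℕ n) i) (lookup-map i inject₁ w)

  value-insertMax-punchIn : ∀ i → value (insertMax pos w) (punchIn pos i) ≡ value w i
  value-insertMax-punchIn i = trans (cong toℕ (lookup-insertMax-punchIn i)) (toℕ-inject₁ (lookup w i))

  value-insertMax : value (insertMax pos w) pos ≡ n
  value-insertMax = trans (cong toℕ lookup-insertMax) (toℕ-fromℕ n)

  insertMax-maximal : ∀ l → ¬ value (insertMax pos w) pos < value (insertMax pos w) l
  insertMax-maximal l lt =
    <⇒≱ lt (subst (value (insertMax pos w) l ≤_) (sym value-insertMax)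
                  (s≤s⁻¹ (toℕ<n (lookup (insertMax pos w) l))))

  SameOrder-insertMax : ∀ {i j k p} →
    SameOrder (value (insertMax pos w) (punchIn pos i)) (value (insertMax pos w) (punchIn pos j))
              (value (insertMax pos w) (punchIn pos k)) p ⇔ SameOrder (value w i) (value w j) (value w k) p
  SameOrder-insertMax {i} {j} {k} = mk⇔
    (SameOrder-respects (value-insertMax-punchIn i) (value-insertMax-punchIn j) (value-insertMax-punchIn k))
    (SameOrder-respects (sym (value-insertMax-punchIn i)) (sym (value-insertMax-punchIn j))
                        (sym (value-insertMax-punchIn k)))

punchIn-or-pos : (pos l : Fin (suc n)) → l ≡ pos ⊎ ∃[ i ] punchIn pos i ≡ l
punchIn-or-pos pos l with l ≟ pos
... | yes l≡pos = inj₁ l≡pos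
... | no l≢pos = inj₂ (punchOut (l≢pos ∘ sym) , punchIn-punchOut (l≢pos ∘ sym))

IsPerm-insertMax : (pos : Fin (suc n)) (w : Vec (Fin n) n) → IsPerm (insertMax pos w) ⇔ IsPerm w
IsPerm-insertMax pos w = mk⇔ down up
  where
  down : IsPerm (insertMax pos w) → IsPerm w
  down pw′ i j e = punchIn-injective pos i j (pw′ _ _
    (trans (lookup-insertMax-punchIn pos w i) (trans (cong inject₁ e) (sym (lookup-insertMax-punchIn pos w j)))))

  max≢other : ∀ i → lookup (insertMax pos w) pos ≢ lookup (insertMax pos w) (punchIn pos i)
  max≢other i e = fromℕ≢inject₁ (trans (sym (lookup-insertMax pos w)) (trans e (lookup-insertMax-punchIn pos w i)))

  up : IsPerm w → IsPerm (insertMax pos w)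
  up pw l l′ e with punchIn-or-pos pos l | punchIn-or-pos pos l′
  ... | inj₁ refl | inj₁ refl = refl
  ... | inj₁ refl | inj₂ (i , refl) = ⊥-elim (max≢other i e)
  ... | inj₂ (i , refl) | inj₁ refl = ⊥-elim (max≢other i (sym e))
  ... | inj₂ (i , refl) | inj₂ (j , refl) = cong (punchIn pos) (pw i j (inject₁-injective
    (trans (sym (lookup-insertMax-punchIn pos w i)) (trans e (lookup-insertMax-punchIn pos w j)))))

insertMax-injective : (pos : Fin (suc n)) {w w′ : Vec (Fin n) n} → insertMax pos w ≡ insertMax pos w′ → w ≡ w′
insertMax-injective pos {w} {w′} e = Pointwise-≡⇒≡ (ext λ i → inject₁-injective
  (trans (sym (lookup-insertMax-punchIn pos w i))
         (trans (cong (λ v → lookup v (punchIn pos i)) e) (lookup-insertMax-punchIn pos w′ i))))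

insertMax-surjective : (pos : Fin (suc n)) (w′ : Vec (Fin (suc n)) (suc n)) → IsPerm w′ →
                       lookup w′ pos ≡ fromℕ n → ∃[ w ] insertMax pos w ≡ w′
insertMax-surjective {n} pos w′ pw′ max-at-pos = w , Pointwise-≡⇒≡ (ext agree)
  where
  not-max : ∀ i → n ≢ toℕ (lookup w′ (punchIn pos i))
  not-max i e = punchInᵢ≢i pos i
    (pw′ _ _ (trans (toℕ-injective (trans (sym e) (sym (toℕ-fromℕ n)))) (sym max-at-pos)))

  w : Vec (Fin n) n
  w = tabulate λ i → lower₁ (lookup w′ (punchIn pos i)) (not-max i)

  agree : ∀ l → lookup (insertMax pos w) l ≡ lookup w′ l
  agree l with punchIn-or-pos pos l
  ... | inj₁ refl = trans (lookup-insertMax pos w) (sym max-at-pos)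
  ... | inj₂ (i , refl) = begin
    lookup (insertMax pos w) (punchIn pos i)         ≡⟨ lookup-insertMax-punchIn pos w i ⟩
    inject₁ (lookup w i)                             ≡⟨ cong inject₁ (lookup∘tabulate _ i) ⟩
    inject₁ (lower₁ (lookup w′ (punchIn pos i)) _)   ≡⟨ inject₁-lower₁ _ (not-max i) ⟩
    lookup w′ (punchIn pos i)                        ∎
    where open ≡-Reasoning

IsPerm⇒surjective : (w : Vec (Fin (suc n)) (suc n)) → IsPerm w → ∀ v → ∃[ i ] lookup w i ≡ v
IsPerm⇒surjective {n} w pw v with any? (λ i → lookup w i ≟ v)
... | yes hit = hit
... | no miss = ⊥-elim (<⇒notInjective (n<1+n n) squeeze-injective)
  where
  squeeze : Fin (suc n) → Fin n
  squeeze i = punchOut (miss ∘ (i ,_) ∘ sym)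

  squeeze-injective : Injective _≡_ _≡_ squeeze
  squeeze-injective {i} {j} e = pw i j (punchOut-injective {i = v} (miss ∘ (i ,_) ∘ sym) (miss ∘ (j ,_) ∘ sym) e)

module _ {x y z : ℕ} (x<z : x < z) (y<z : y < z) where

  private
    p : Pat3
    p = pat x y z

  dashFirst-insertMax-zero : (w : Vec (Fin n) n) → ContainsDashFirst p (insertMax zero w) ⇔ ContainsDashFirst p w
  dashFirst-insertMax-zero w = mk⇔ down up
    where
    down : ContainsDashFirst p (insertMax zero w) → ContainsDashFirst p w
    down (zero , _ , _ , _ , j′ , _ , s) = ⊥-elim (insertMax-maximal zero w j′ (from (proj₁ (proj₂ s)) x<z))
    down (suc i , suc j , s≤s i<j , s≤s j+1<n , suc j′ , j′≡1+j , s) =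
      i , j , i<j , j+1<n , j′ , ℕ-suc-injective j′≡1+j , to (SameOrder-insertMax zero w) s

    up : ContainsDashFirst p w → ContainsDashFirst p (insertMax zero w)
    up (i , j , i<j , j+1<n , j′ , j′≡1+j , s) =
      suc i , suc j , s≤s i<j , s≤s j+1<n , suc j′ , cong suc j′≡1+j , from (SameOrder-insertMax zero w) s

  dashFirst-insertMax-one : (w : Vec (Fin (suc n)) (suc n)) →
                            ContainsDashFirst p (insertMax (suc zero) w) ⇔ ContainsDashFirst p w
  dashFirst-insertMax-one w = mk⇔ down up
    where
    down : ContainsDashFirst p (insertMax (suc zero) w) → ContainsDashFirst p w
    down (_ , suc zero , _ , _ , j′ , _ , s) =
      ⊥-elim (insertMax-maximal (suc zero) w j′ (from (proj₂ (proj₂ s)) y<z))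
    down (suc zero , _ , _ , _ , j′ , _ , s) =
      ⊥-elim (insertMax-maximal (suc zero) w j′ (from (proj₁ (proj₂ s)) x<z))
    down (zero , suc (suc j) , _ , s≤s j+1<n , suc (suc j′) , j′≡1+j , s) =
      zero , suc j , z<s , j+1<n , suc j′ , ℕ-suc-injective j′≡1+j , to (SameOrder-insertMax (suc zero) w) s
    down (suc (suc i) , suc (suc j) , s≤s i<j , s≤s j+1<n , suc (suc j′) , j′≡1+j , s) =
      suc i , suc j , i<j , j+1<n , suc j′ , ℕ-suc-injective j′≡1+j , to (SameOrder-insertMax (suc zero) w) s

    up : ContainsDashFirst p w → ContainsDashFirst p (insertMax (suc zero) w)
    up (zero , suc j , _ , j+1<n , suc j′ , j′≡1+j , s) =
      zero , suc (suc j) , z<s , s≤s j+1<n , suc (suc j′) , cong suc j′≡1+j ,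
      from (SameOrder-insertMax (suc zero) w) s
    up (suc i , suc j , i<j , j+1<n , suc j′ , j′≡1+j , s) =
      suc (suc i) , suc (suc j) , s≤s i<j , s≤s j+1<n , suc (suc j′) , cong suc j′≡1+j ,
      from (SameOrder-insertMax (suc zero) w) s

value-<-max : (w : Vec (Fin (suc n)) (suc n)) → IsPerm w → ∀ {k l} → lookup w k ≡ fromℕ n → l ≢ k →
              value w l < value w k
value-<-max {n} w pw {k} {l} max-at-k l≢k rewrite max-at-k | toℕ-fromℕ n =
  ≤∧≢⇒< (s≤s⁻¹ (toℕ<n (lookup w l)))
        (λ e → l≢k (pw l k (trans (toℕ-injective (trans e (sym (toℕ-fromℕ n)))) (sym max-at-k))))

max-after-second-contains : (w : Vec (Fin (suc (suc n))) (suc (suc n))) → IsPerm w → (k : Fin n) →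
                            lookup w (suc (suc k)) ≡ fromℕ (suc n) →
                            Contains (1 - (2 , 3)) w ⊎ Contains (2 - (1 , 3)) w
max-after-second-contains w pw k max-at-k = by-cases (<-cmp a b)
  where
  a b c : ℕ
  a = value w zero
  b = value w (suc (inject₁ k))
  c = value w (suc (suc k))

  adjacent : toℕ (suc (suc k)) ≡ suc (toℕ (suc (inject₁ k)))
  adjacent = cong (λ t → suc (suc t)) (sym (toℕ-inject₁ k))

  a<c : a < c
  a<c = value-<-max w pw max-at-k (λ ())

  b<c : b < c
  b<c = value-<-max w pw max-at-k (λ e → <⇒≢ (≤-reflexive (sym adjacent)) (cong toℕ e))

  occurrence : ∀ {p} → SameOrder a b c p → ContainsDashFirst p w
  occurrence s = zero , suc (inject₁ k) , z<s , s≤s (s≤s (inject₁ℕ< k)) , suc (suc k) , adjacent , s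

  by-cases : Tri (a < b) (a ≡ b) (b < a) → Contains (1 - (2 , 3)) w ⊎ Contains (2 - (1 , 3)) w
  by-cases (tri< a<b _ _) =
    inj₁ (occurrence (⇔-of-both a<b (s<s z<s) , ⇔-of-both a<c (s<s z<s) , ⇔-of-both b<c (s<s (s<s z<s))))
  by-cases (tri≈ _ a≡b _) = ⊥-elim (values-distinct w pw z<s a≡b)
  by-cases (tri> _ _ b<a) =
    inj₂ (occurrence (⇔-of-neither (<-asym b<a) (λ { (s≤s ()) }) , ⇔-of-both a<c (s<s (s<s z<s)) ,
                      ⇔-of-both b<c (s<s z<s)))

insertMax-front : Vec (Fin (suc n)) (suc n) ⊎ Vec (Fin (suc n)) (suc n) → Vec (Fin (suc (suc n))) (suc (suc n))
insertMax-front = [ insertMax zero , insertMax (suc zero) ]′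

insertMax-front-injective : Injective _≡_ _≡_ (insertMax-front {n})
insertMax-front-injective {x = inj₁ w} {inj₁ w′} e = cong inj₁ (insertMax-injective zero e)
insertMax-front-injective {x = inj₁ w} {inj₂ (_ ∷ w′)} e = ⊥-elim (fromℕ≢inject₁ (∷-injectiveˡ e))
insertMax-front-injective {x = inj₂ (_ ∷ w)} {inj₁ w′} e = ⊥-elim (fromℕ≢inject₁ (sym (∷-injectiveˡ e)))
insertMax-front-injective {x = inj₂ w} {inj₂ w′} e = cong inj₂ (insertMax-injective (suc zero) e)

S[1-23,2-13] : (n : ℕ) → Vec (Fin n) n → Set
S[1-23,2-13] n = InS n (1 - (2 , 3)) (2 - (1 , 3))

S[1-23,2-13]-⇔ : (w : Vec (Fin n) n) (w′ : Vec (Fin m) m) → (IsPerm w ⇔ IsPerm w′) →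
                 (∀ {x y z} → x < z → y < z →
                    ContainsDashFirst (pat x y z) w ⇔ ContainsDashFirst (pat x y z) w′) →
                 S[1-23,2-13] n w ⇔ S[1-23,2-13] m w′
S[1-23,2-13]-⇔ w w′ perm⇔ dashFirst⇔ =
  InS-⇔ {p = 1 - (2 , 3)} {2 - (1 , 3)} {1 - (2 , 3)} {2 - (1 , 3)} {w = w} {w′ = w′} perm⇔
    (λ _ → dashFirst⇔ (s<s z<s) (s<s (s<s z<s))) (λ _ → dashFirst⇔ (s<s (s<s z<s)) (s<s z<s))

S[1-23,2-13]-insertMax-zero : (w : Vec (Fin n) n) → S[1-23,2-13] (suc n) (insertMax zero w) ⇔ S[1-23,2-13] n w
S[1-23,2-13]-insertMax-zero w =
  S[1-23,2-13]-⇔ (insertMax zero w) w (IsPerm-insertMax zero w) (λ x<z y<z → dashFirst-insertMax-zero x<z y<z w)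

S[1-23,2-13]-insertMax-one : (w : Vec (Fin (suc n)) (suc n)) →
                             S[1-23,2-13] (suc (suc n)) (insertMax (suc zero) w) ⇔ S[1-23,2-13] (suc n) w
S[1-23,2-13]-insertMax-one w =
  S[1-23,2-13]-⇔ (insertMax (suc zero) w) w (IsPerm-insertMax (suc zero) w)
    (λ x<z y<z → dashFirst-insertMax-one x<z y<z w)

S[1-23,2-13]-insertMax-front : ∀ v → (S[1-23,2-13] (suc n) ⟨⊎⟩ S[1-23,2-13] (suc n)) v →
                               S[1-23,2-13] (suc (suc n)) (insertMax-front v)
S[1-23,2-13]-insertMax-front (inj₁ w) = from (S[1-23,2-13]-insertMax-zero w)
S[1-23,2-13]-insertMax-front (inj₂ w) = from (S[1-23,2-13]-insertMax-one w)

S[1-23,2-13]-decompose : ∀ w′ → S[1-23,2-13] (suc (suc n)) w′ →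
                         ∃[ v ] (S[1-23,2-13] (suc n) ⟨⊎⟩ S[1-23,2-13] (suc n)) v × insertMax-front v ≡ w′
S[1-23,2-13]-decompose {n} w′ s@(pw′ , avoid-1-23 , avoid-2-13) with IsPerm⇒surjective w′ pw′ (fromℕ (suc n))
... | zero , max-at-0 = let w , e = insertMax-surjective zero w′ pw′ max-at-0 in
  inj₁ w , to (S[1-23,2-13]-insertMax-zero w) (subst (S[1-23,2-13] _) (sym e) s) , e
... | suc zero , max-at-1 = let w , e = insertMax-surjective (suc zero) w′ pw′ max-at-1 in
  inj₂ w , to (S[1-23,2-13]-insertMax-one w) (subst (S[1-23,2-13] _) (sym e) s) , e
... | suc (suc k) , max-at-k = ⊥-elim ([ avoid-1-23 , avoid-2-13 ]′ (max-after-second-contains w′ pw′ k max-at-k))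

card-S[1-23,2-13] : ∀ n → HasCard (suc n) (1 - (2 , 3)) (2 - (1 , 3)) (2 ^ n)
card-S[1-23,2-13] zero =
  (λ _ → zero ∷ []) , (λ _ → single) , (λ { zero zero _ → refl }) , (λ { (zero ∷ []) _ → zero , refl })
  where
  single : S[1-23,2-13] 1 (zero ∷ [])
  single = (λ { zero zero _ → refl }) , (λ { (_ , _ , _ , s≤s () , _) }) , (λ { (_ , _ , _ , s≤s () , _) })
card-S[1-23,2-13] (suc n) = subst (Counts (S[1-23,2-13] (suc (suc n)))) (cong (2 ^ n +_) (sym (+-identityʳ (2 ^ n))))
  (Counts-image insertMax-front insertMax-front-injective S[1-23,2-13]-insertMax-front S[1-23,2-13]-decompose
    (Counts-⊎ (card-S[1-23,2-13] n) (card-S[1-23,2-13] n)))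

card-S[3-21,2-31] : ∀ n → HasCard (suc n) (3 - (2 , 1)) (2 - (3 , 1)) (2 ^ n)
card-S[3-21,2-31] n =
  HasCard-transport {p = 1 - (2 , 3)} {2 - (1 , 3)} {3 - (2 , 1)} {2 - (3 , 1)}
    complement complement-involutive complement-IsPerm
    (λ w pw → dashFirst-complement-⇔ w pw ((λ ()) , (λ ()) , (λ ())) ((λ ()) , (λ ()) , (λ ()))
                (Mirrored-by-computation refl refl refl))
    (λ w pw → dashFirst-complement-⇔ w pw ((λ ()) , (λ ()) , (λ ())) ((λ ()) , (λ ()) , (λ ()))
                (Mirrored-by-computation refl refl refl))
    (card-S[1-23,2-13] n)

HasCard-reverse : ∀ {x y z x′ y′ z′} → Distinct x y z → Distinct x′ y′ z′ →
                  HasCard n (x - (y , z)) (x′ - (y′ , z′)) k → HasCard n ((z , y) ⁻ x) ((z′ , y′) ⁻ x′) k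
HasCard-reverse {x = x} {y} {z} {x′} {y′} {z′} xyz x′y′z′ =
  HasCard-transport {p = x - (y , z)} {x′ - (y′ , z′)} {(z , y) ⁻ x} {(z′ , y′) ⁻ x′}
    reverse reverse-involutive reverse-IsPerm
    (λ w pw → dashFirst-reverse-⇔ w pw xyz) (λ w pw → dashFirst-reverse-⇔ w pw x′y′z′)

card-S[12-3,13-2] : ∀ n → HasCard (suc n) ((1 , 2) ⁻ 3) ((1 , 3) ⁻ 2) (2 ^ n)
card-S[12-3,13-2] n = HasCard-reverse ((λ ()) , (λ ()) , (λ ())) ((λ ()) , (λ ()) , (λ ())) (card-S[3-21,2-31] n)

card-S[32-1,31-2] : ∀ n → HasCard (suc n) ((3 , 2) ⁻ 1) ((3 , 1) ⁻ 2) (2 ^ n)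
card-S[32-1,31-2] n = HasCard-reverse ((λ ()) , (λ ()) , (λ ())) ((λ ()) , (λ ()) , (λ ())) (card-S[1-23,2-13] n)

mainTheorem4 : (n : ℕ) → n ≥ 1 →
    HasCard n (1 - (2 , 3)) (2 - (1 , 3)) (2 ^ (n ∸ 1)) ×
    HasCard n (3 - (2 , 1)) (2 - (3 , 1)) (2 ^ (n ∸ 1)) ×
    HasCard n ((1 , 2) ⁻ 3) ((1 , 3) ⁻ 2) (2 ^ (n ∸ 1)) ×
    HasCard n ((3 , 2) ⁻ 1) ((3 , 1) ⁻ 2) (2 ^ (n ∸ 1))
mainTheorem4 (suc n) _ = card-S[1-23,2-13] n , card-S[3-21,2-31] n , card-S[12-3,13-2] n , card-S[32-1,31-2] n
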